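{- Let $\alpha,\beta$ be nonzero real or complex numbers and $r,x$ real or complex numbers. For every integer $m\ge0$, as formal power series in $t$, $$\sum_{n=0}^{\infty}S_{n+m}(x;\alpha,\beta,r)\frac{t^n}{n!}=(1+\alpha t)^{\frac{r-m\alpha}{\alpha}}\exp\!\Big(\frac{x}{\beta}\big[(1+\alpha t)^{\beta/\alpha}-1\big]\Big)\,S_m\big(x(1+\alpha t)^{\beta/\alpha};\alpha,\beta,r\big).$$
   Context: For a number $\alpha$ and integer $n\ge0$, $(t|\alpha)_n=t(t-\alpha)\cdots(t-(n-1)\alpha)$, $(t|\alpha)_0=1$. For numbers $\alpha,\beta,\gamma$ the generalised Stirling numbers $S(n,k,\alpha,\beta,\gamma)$, $0\le k\le n$, are defined by the polynomial identity $(t|\alpha)_n=\sum_{k=0}^{n}S(n,k,\alpha,\beta,\gamma)(t-\gamma|\beta)_k$. The generalised exponential polynomials are $S_n(y;\alpha,\beta,r)=\sum_{k=0}^{n}S(n,k,\alpha,\beta,r)\,y^k$; they have exponential generating function $\sum_{n\ge0}S_n(y;\alpha,\beta,r)\frac{t^n}{n!}=(1+\alpha t)^{r/\alpha}\exp\big(\frac{y}{\beta}[(1+\alpha t)^{\beta/\alpha}-1]\big)$. Powers $(1+\alpha t)^{c}$ denote the formal binomial series $\sum_{j\ge0}\binom{c}{j}(\alpha t)^j$. -}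

module Defs where

open import Level using (_⊔_) renaming (suc to lsuc)
open import Algebra.Bundles using (CommutativeRing)
open import Data.Nat using (ℕ; zero; suc; _∸_) renaming (_+_ to _+ℕ_)
open import Relation.Nullary using (¬_)

natR : ∀ {c ℓ} (R : CommutativeRing c ℓ) → ℕ → CommutativeRing.Carrier R
natR R zero    = CommutativeRing.0# R
natR R (suc n) = CommutativeRing._+_ R (CommutativeRing.1# R) (natR R n)

-- A field of characteristic zero (stdlib has no Field bundle).
-- The inverse is a total function, only constrained on nonzero elements.
record CharZeroField c ℓ : Set (lsuc (c ⊔ ℓ)) where
  field
    cring : CommutativeRing c ℓ
  open CommutativeRing cring public
  field
    _⁻¹      : Carrier → Carrier
    inverse  : ∀ x → ¬ (x ≈ 0#) → x * (x ⁻¹) ≈ 1#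
    charZero : ∀ n → ¬ (natR cring (suc n) ≈ 0#)

  nat : ℕ → Carrier
  nat = natR cring

module FPS {c ℓ} (F : CharZeroField c ℓ) where
  open CharZeroField F

  infixl 6 _−_
  _−_ : Carrier → Carrier → Carrier
  x − y = x + (- y)

  -- Σ_{k=0}^{n} f k   (inclusive upper bound)
  Σ≤ : ℕ → (ℕ → Carrier) → Carrier
  Σ≤ zero    f = f 0
  Σ≤ (suc n) f = Σ≤ n f + f (suc n)

  Π< : ℕ → (ℕ → Carrier) → Carrier
  Π< zero    f = 1#
  Π< (suc n) f = Π< n f * f n

  pow : Carrier → ℕ → Carrier
  pow y zero    = 1#
  pow y (suc k) = pow y k * y

  fact : ℕ → Carrier
  fact n = Π< n (λ i → nat (suc i))

  falling : Carrier → Carrier → ℕ → Carrier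
  falling t α n = Π< n (λ i → t − nat i * α)

  -- S n k = S(n,k,α,β,γ) : the defining polynomial identity
  --   (t|α)_n = Σ_{k=0}^{n} S(n,k) (t-γ|β)_k,
  -- required for every t of the (infinite) field, which for a field of
  -- characteristic zero is equivalent to the identity of polynomials in t.
  IsGenStirling : Carrier → Carrier → Carrier → (ℕ → ℕ → Carrier) → Set (c ⊔ ℓ)
  IsGenStirling α β γ S =
    ∀ (n : ℕ) (t : Carrier) → falling t α n ≈ Σ≤ n (λ k → S n k * falling (t − γ) β k)

  expPoly : (ℕ → ℕ → Carrier) → ℕ → Carrier → Carrier
  expPoly S n y = Σ≤ n (λ k → S n k * pow y k)

  -- formal power series in t: coefficient sequences
  PS : Set c
  PS = ℕ → Carrier

  oneS : PS
  oneS zero    = 1#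
  oneS (suc _) = 0#

  _⊛_ : PS → PS → PS
  (f ⊛ g) n = Σ≤ n (λ k → f k * g (n ∸ k))

  scaleS : Carrier → PS → PS
  scaleS a f n = a * f n

  _⊖_ : PS → PS → PS
  (f ⊖ g) n = f n − g n

  powS : PS → ℕ → PS
  powS f zero    = oneS
  powS f (suc k) = powS f k ⊛ f

  binom : Carrier → ℕ → Carrier
  binom c j = Π< j (λ i → c − nat i) * (fact j ⁻¹)

  -- (1 + a t)^c = Σ_j binom(c,j) (a t)^j
  binomS : Carrier → Carrier → PS
  binomS a c j = binom c j * pow a j

  -- exp(G) = Σ_k G^k / k!  for a series G with zero constant term
  -- (then G^k has no terms below t^k, so coefficient n only involves k ≤ n)
  expS : PS → PS
  expS G n = Σ≤ n (λ k → powS G k n * (fact k ⁻¹))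

  expPolyS : (ℕ → ℕ → Carrier) → ℕ → PS → PS
  expPolyS S m Y n = Σ≤ m (λ k → S m k * powS Y k n)

  lhsS : (ℕ → ℕ → Carrier) → ℕ → Carrier → PS
  lhsS S m x n = expPoly S (n +ℕ m) x * (fact n ⁻¹)

  rhsS : Carrier → Carrier → Carrier → Carrier → (ℕ → ℕ → Carrier) → ℕ → PS
  rhsS α β r x S m =
    (binomS α ((r − nat m * α) * (α ⁻¹))
      ⊛ expS (scaleS (x * (β ⁻¹)) (binomS α (β * (α ⁻¹)) ⊖ oneS)))
      ⊛ expPolyS S m (scaleS x (binomS α (β * (α ⁻¹))))

-- Write R_m for the right-hand side.  The proof shows  D R_m = R_{m+1}  for the
-- formal derivative D, and that the constant term of R_m is S_m(x).  Then
-- D^N R_0 = R_N gives  N! [t^N] R_0 = S_N(x), i.e. R_0 is the exponential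
-- generating function of the S_N(x), and  n! [tⁿ] R_m = n! [tⁿ] D^m R_0 =
-- (n+m)! [t^{n+m}] R_0 = S_{n+m}(x),  which is the theorem.
module Submission where

open import Defs
open import Data.Nat as ℕ using (ℕ; zero; suc; _∸_; _≤_; _<_; z≤n)
import Data.Nat.Properties as ℕₚ
open import Data.Product using (_,_)
open import Data.Sum using (inj₁; inj₂)
open import Data.Empty using (⊥-elim)
open import Relation.Nullary using (¬_; yes; no)
open import Relation.Binary.PropositionalEquality as ≡ using (_≡_)
open import Algebra.Bundles using (CommutativeRing)
open import Algebra.Structures using (IsCommutativeRing)
import Algebra.Properties.CommutativeSemigroup as CommutativeSemigroupProperties
import Algebra.Properties.Ring as RingProperties
import Algebra.Solver.Ring.NaturalCoefficients.Default as SemiringSolver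
import Relation.Binary.Reasoning.Setoid as SetoidReasoning

module Sums {c ℓ} (F : CharZeroField c ℓ) where
  open CharZeroField F
  open FPS F
  open SetoidReasoning setoid
  open CommutativeSemigroupProperties +-commutativeSemigroup using () renaming (interchange to +-interchange)

  ≡⇒≈ : ∀ {a b} → a ≡ b → a ≈ b
  ≡⇒≈ ≡.refl = refl

  Σ-cong : ∀ n {f g : ℕ → Carrier} → (∀ k → f k ≈ g k) → Σ≤ n f ≈ Σ≤ n g
  Σ-cong zero    f≈g = f≈g 0
  Σ-cong (suc n) f≈g = +-cong (Σ-cong n f≈g) (f≈g (suc n))

  Σ-cong≤ : ∀ n {f g : ℕ → Carrier} → (∀ k → k ≤ n → f k ≈ g k) → Σ≤ n f ≈ Σ≤ n g
  Σ-cong≤ zero    f≈g = f≈g 0 z≤n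
  Σ-cong≤ (suc n) f≈g =
    +-cong (Σ-cong≤ n (λ k k≤n → f≈g k (ℕₚ.m≤n⇒m≤1+n k≤n))) (f≈g (suc n) ℕₚ.≤-refl)

  Σ-+ : ∀ n (f g : ℕ → Carrier) → Σ≤ n (λ k → f k + g k) ≈ Σ≤ n f + Σ≤ n g
  Σ-+ zero    f g = refl
  Σ-+ (suc n) f g = trans (+-congʳ (Σ-+ n f g)) (+-interchange _ _ _ _)

  Σ-*ˡ : ∀ n a (f : ℕ → Carrier) → a * Σ≤ n f ≈ Σ≤ n (λ k → a * f k)
  Σ-*ˡ zero    a f = refl
  Σ-*ˡ (suc n) a f = trans (distribˡ a _ _) (+-congʳ (Σ-*ˡ n a f))

  Σ-*ʳ : ∀ n a (f : ℕ → Carrier) → Σ≤ n f * a ≈ Σ≤ n (λ k → f k * a)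
  Σ-*ʳ zero    a f = refl
  Σ-*ʳ (suc n) a f = trans (distribʳ a _ _) (+-congʳ (Σ-*ʳ n a f))

  Σ-peel : ∀ n (f : ℕ → Carrier) → Σ≤ (suc n) f ≈ f 0 + Σ≤ n (λ k → f (suc k))
  Σ-peel zero    f = refl
  Σ-peel (suc n) f = trans (+-congʳ (Σ-peel n f)) (+-assoc _ _ _)

  Σ-zero : ∀ n (f : ℕ → Carrier) → (∀ k → k ≤ n → f k ≈ 0#) → Σ≤ n f ≈ 0#
  Σ-zero n f f≈0 = trans (Σ-cong≤ n f≈0) (zeros n)
    where
    zeros : ∀ n → Σ≤ n (λ _ → 0#) ≈ 0#
    zeros zero    = refl
    zeros (suc n) = trans (+-identityʳ _) (zeros n)

  Σ-head : ∀ n (f : ℕ → Carrier) → (∀ k → f (suc k) ≈ 0#) → Σ≤ n f ≈ f 0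
  Σ-head zero    f tail≈0 = refl
  Σ-head (suc n) f tail≈0 = begin
    Σ≤ (suc n) f                     ≈⟨ Σ-peel n f ⟩
    f 0 + Σ≤ n (λ k → f (suc k))     ≈⟨ +-congˡ (Σ-zero n _ (λ k _ → tail≈0 k)) ⟩
    f 0 + 0#                         ≈⟨ +-identityʳ _ ⟩
    f 0                              ∎

  Σ-swap : ∀ n m (f : ℕ → ℕ → Carrier) →
           Σ≤ n (λ i → Σ≤ m (λ j → f i j)) ≈ Σ≤ m (λ j → Σ≤ n (λ i → f i j))
  Σ-swap zero    m f = refl
  Σ-swap (suc n) m f = trans (+-congʳ (Σ-swap n m f)) (sym (Σ-+ m _ _))

  Σ-extend : ∀ n N (f : ℕ → Carrier) → n ≤ N → (∀ k → n < k → f k ≈ 0#) → Σ≤ N f ≈ Σ≤ n f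
  Σ-extend n zero    f z≤n tail≈0 = refl
  Σ-extend n (suc N) f n≤N tail≈0 with ℕₚ.m≤n⇒m<n∨m≡n n≤N
  ... | inj₂ ≡.refl = refl
  ... | inj₁ n<1+N  = begin
    Σ≤ N f + f (suc N) ≈⟨ +-cong (Σ-extend n N f (ℕₚ.≤-pred n<1+N) tail≈0) (tail≈0 (suc N) n<1+N) ⟩
    Σ≤ n f + 0#        ≈⟨ +-identityʳ _ ⟩
    Σ≤ n f             ∎

  Σ-reverse : ∀ n (h : ℕ → ℕ → Carrier) → Σ≤ n (λ k → h k (n ∸ k)) ≈ Σ≤ n (λ k → h (n ∸ k) k)
  Σ-reverse zero    h = refl
  Σ-reverse (suc n) h = begin
    Σ≤ (suc n) (λ k → h k (suc n ∸ k))            ≈⟨ Σ-peel n _ ⟩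
    h 0 (suc n) + Σ≤ n (λ k → h (suc k) (n ∸ k))  ≈⟨ +-congˡ (Σ-reverse n (λ a → h (suc a))) ⟩
    h 0 (suc n) + Σ≤ n (λ k → h (suc (n ∸ k)) k)  ≈⟨ +-comm _ _ ⟩
    Σ≤ n (λ k → h (suc (n ∸ k)) k) + h 0 (suc n)
      ≈⟨ +-cong (Σ-cong≤ n (λ k k≤n → ≡⇒≈ (≡.cong (λ i → h i k) (≡.sym (ℕₚ.+-∸-assoc 1 k≤n)))))
                (≡⇒≈ (≡.cong (λ i → h i (suc n)) (≡.sym (ℕₚ.n∸n≡0 n)))) ⟩
    Σ≤ (suc n) (λ k → h (suc n ∸ k) k)            ∎

  Σ-triangle : ∀ n (G : ℕ → ℕ → ℕ → Carrier) →
               Σ≤ n (λ l → Σ≤ l (λ k → G k (l ∸ k) (n ∸ l)))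
               ≈ Σ≤ n (λ k → Σ≤ (n ∸ k) (λ j → G k j (n ∸ k ∸ j)))
  Σ-triangle zero    G = refl
  Σ-triangle (suc n) G = begin
    Σ≤ (suc n) (λ l → Σ≤ l (λ k → G k (l ∸ k) (suc n ∸ l)))                ≈⟨ Σ-peel n _ ⟩
    G 0 0 (suc n) + Σ≤ n (λ l → Σ≤ (suc l) (λ k → G k (suc l ∸ k) (n ∸ l)))
      ≈⟨ +-congˡ (trans (Σ-cong n (λ l → Σ-peel l _)) (Σ-+ n _ _)) ⟩
    G 0 0 (suc n) + (Σ≤ n (λ l → G 0 (suc l) (n ∸ l))
                     + Σ≤ n (λ l → Σ≤ l (λ k → G (suc k) (l ∸ k) (n ∸ l))))  ≈⟨ +-assoc _ _ _ ⟨
    (G 0 0 (suc n) + Σ≤ n (λ l → G 0 (suc l) (n ∸ l)))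
      + Σ≤ n (λ l → Σ≤ l (λ k → G (suc k) (l ∸ k) (n ∸ l)))
      ≈⟨ +-cong (sym (Σ-peel n _)) (Σ-triangle n (λ k → G (suc k))) ⟩
    Σ≤ (suc n) (λ j → G 0 j (suc n ∸ j))
      + Σ≤ n (λ k → Σ≤ (n ∸ k) (λ j → G (suc k) j (n ∸ k ∸ j)))             ≈⟨ Σ-peel n _ ⟨
    Σ≤ (suc n) (λ k → Σ≤ (suc n ∸ k) (λ j → G k j (suc n ∸ k ∸ j)))        ∎

  Π-cong : ∀ n {f g : ℕ → Carrier} → (∀ k → f k ≈ g k) → Π< n f ≈ Π< n g
  Π-cong zero    f≈g = refl
  Π-cong (suc n) f≈g = *-cong (Π-cong n f≈g) (f≈g n)

  Π-peel : ∀ n (f : ℕ → Carrier) → Π< (suc n) f ≈ f 0 * Π< n (λ k → f (suc k))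
  Π-peel zero    f = trans (*-identityˡ _) (sym (*-identityʳ _))
  Π-peel (suc n) f = trans (*-congʳ (Π-peel n f)) (*-assoc _ _ _)

module FieldFacts {c ℓ} (F : CharZeroField c ℓ) where
  open CharZeroField F
  open FPS F
  open SetoidReasoning setoid

  1≉0 : ¬ (1# ≈ 0#)
  1≉0 1≈0 = charZero 0 (trans (+-identityʳ 1#) 1≈0)

  inverse-cancel : ∀ {a} → ¬ (a ≈ 0#) → ∀ b → a ⁻¹ * (a * b) ≈ b
  inverse-cancel {a} a≉0 b = begin
    a ⁻¹ * (a * b) ≈⟨ *-assoc _ _ _ ⟨
    (a ⁻¹ * a) * b ≈⟨ *-congʳ (trans (*-comm _ _) (inverse a a≉0)) ⟩
    1# * b         ≈⟨ *-identityˡ b ⟩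
    b              ∎

  *-cancelˡ : ∀ {a b b′} → ¬ (a ≈ 0#) → a * b ≈ a * b′ → b ≈ b′
  *-cancelˡ {a} {b} {b′} a≉0 ab≈ab′ = begin
    b              ≈⟨ inverse-cancel a≉0 b ⟨
    a ⁻¹ * (a * b)  ≈⟨ *-congˡ ab≈ab′ ⟩
    a ⁻¹ * (a * b′) ≈⟨ inverse-cancel a≉0 b′ ⟩
    b′              ∎

  *-nonzero : ∀ {a b} → ¬ (a ≈ 0#) → ¬ (b ≈ 0#) → ¬ (a * b ≈ 0#)
  *-nonzero a≉0 b≉0 ab≈0 = b≉0 (*-cancelˡ a≉0 (trans ab≈0 (sym (zeroʳ _))))

  Π-nonzero : ∀ n (f : ℕ → Carrier) → (∀ i → i < n → ¬ (f i ≈ 0#)) → ¬ (Π< n f ≈ 0#)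
  Π-nonzero zero    f fᵢ≉0 = 1≉0
  Π-nonzero (suc n) f fᵢ≉0 =
    *-nonzero (Π-nonzero n f (λ i i<n → fᵢ≉0 i (ℕₚ.m<n⇒m<1+n i<n))) (fᵢ≉0 n ℕₚ.≤-refl)

  inverse-unique : ∀ {a y} → ¬ (a ≈ 0#) → a * y ≈ 1# → y ≈ a ⁻¹
  inverse-unique {a} a≉0 ay≈1 = *-cancelˡ a≉0 (trans ay≈1 (sym (inverse a a≉0)))

  inverse-* : ∀ {a b} → ¬ (a ≈ 0#) → ¬ (b ≈ 0#) → (a * b) ⁻¹ ≈ a ⁻¹ * b ⁻¹
  inverse-* {a} {b} a≉0 b≉0 = sym (inverse-unique (*-nonzero a≉0 b≉0) (begin
    (a * b) * (a ⁻¹ * b ⁻¹) ≈⟨ swap ⟩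
    (a * a ⁻¹) * (b * b ⁻¹) ≈⟨ *-cong (inverse a a≉0) (inverse b b≉0) ⟩
    1# * 1#                 ≈⟨ *-identityʳ 1# ⟩
    1#                      ∎))
    where
    open SemiringSolver commutativeSemiring using (solve; _:=_; _:*_)
    swap : (a * b) * (a ⁻¹ * b ⁻¹) ≈ (a * a ⁻¹) * (b * b ⁻¹)
    swap = solve 4 (λ a b a′ b′ → (a :* b) :* (a′ :* b′) := (a :* a′) :* (b :* b′)) refl
             a b (a ⁻¹) (b ⁻¹)

  inverse-1 : 1# ⁻¹ ≈ 1#
  inverse-1 = sym (inverse-unique 1≉0 (*-identityʳ 1#))

  nat-+ : ∀ a b → nat (a ℕ.+ b) ≈ nat a + nat b
  nat-+ zero    b = sym (+-identityˡ _)
  nat-+ (suc a) b = trans (+-congˡ (nat-+ a b)) (sym (+-assoc _ _ _))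

  -- n! ≠ 0: this is where characteristic zero is used
  fact-nonzero : ∀ n → ¬ (fact n ≈ 0#)
  fact-nonzero zero    = 1≉0
  fact-nonzero (suc n) = *-nonzero (fact-nonzero n) (charZero n)

  fact-suc-inverse : ∀ n → fact (suc n) ⁻¹ ≈ fact n ⁻¹ * nat (suc n) ⁻¹
  fact-suc-inverse n = inverse-* (fact-nonzero n) (charZero n)

  nat-fact-inverse : ∀ n → nat (suc n) * fact (suc n) ⁻¹ ≈ fact n ⁻¹
  nat-fact-inverse n = begin
    N * fact (suc n) ⁻¹     ≈⟨ *-congˡ (fact-suc-inverse n) ⟩
    N * (fact n ⁻¹ * N ⁻¹)  ≈⟨ *-congˡ (*-comm _ _) ⟩
    N * (N ⁻¹ * fact n ⁻¹)  ≈⟨ *-assoc _ _ _ ⟨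
    (N * N ⁻¹) * fact n ⁻¹  ≈⟨ *-congʳ (inverse N (charZero n)) ⟩
    1# * fact n ⁻¹          ≈⟨ *-identityˡ _ ⟩
    fact n ⁻¹               ∎
    where N = nat (suc n)

  divide-by-fact : ∀ n {a b} → fact n * a ≈ b → a ≈ b * fact n ⁻¹
  divide-by-fact n {a} {b} n!a≈b = begin
    a                        ≈⟨ inverse-cancel (fact-nonzero n) a ⟨
    fact n ⁻¹ * (fact n * a) ≈⟨ *-congˡ n!a≈b ⟩
    fact n ⁻¹ * b            ≈⟨ *-comm _ _ ⟩
    b * fact n ⁻¹            ∎

-- Formal power series (coefficient sequences) form a commutative ring under
-- coefficientwise equality _≋_, addition _⊕_ and the Cauchy product _⊛_;
-- having the ring lets us normalise series expressions with the ring solver.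
module SeriesRing {c ℓ} (F : CharZeroField c ℓ) where
  open CharZeroField F
  open FPS F
  open Sums F
  open SetoidReasoning setoid

  infix 4 _≋_
  record _≋_ (f g : PS) : Set ℓ where
    constructor mk
    field at : ∀ n → f n ≈ g n
  open _≋_ public

  infixl 6 _⊕_
  _⊕_ : PS → PS → PS
  (f ⊕ g) n = f n + g n

  negS : PS → PS
  negS f n = - f n

  zeroS : PS
  zeroS _ = 0#

  ≋-refl : ∀ {f} → f ≋ f
  ≋-refl = mk λ _ → refl

  ≋-sym : ∀ {f g} → f ≋ g → g ≋ f
  ≋-sym f≋g = mk λ n → sym (at f≋g n)

  ≋-trans : ∀ {f g h} → f ≋ g → g ≋ h → f ≋ h
  ≋-trans f≋g g≋h = mk λ n → trans (at f≋g n) (at g≋h n)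

  ⊕-cong : ∀ {f f′ g g′} → f ≋ f′ → g ≋ g′ → f ⊕ g ≋ f′ ⊕ g′
  ⊕-cong f≋f′ g≋g′ = mk λ n → +-cong (at f≋f′ n) (at g≋g′ n)

  ⊛-cong : ∀ {f f′ g g′} → f ≋ f′ → g ≋ g′ → f ⊛ g ≋ f′ ⊛ g′
  ⊛-cong f≋f′ g≋g′ = mk λ n → Σ-cong n (λ k → *-cong (at f≋f′ k) (at g≋g′ (n ∸ k)))

  -- one-sided congruences; the fixed factor is explicit because it cannot
  -- be inferred through the unfolding of _⊛_ and _⊕_
  ⊛-congˡ : ∀ f {g g′} → g ≋ g′ → f ⊛ g ≋ f ⊛ g′
  ⊛-congˡ f = ⊛-cong (≋-refl {f})

  ⊛-congʳ : ∀ g {f f′} → f ≋ f′ → f ⊛ g ≋ f′ ⊛ g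
  ⊛-congʳ g f≋f′ = ⊛-cong f≋f′ (≋-refl {g})

  ⊕-congˡ : ∀ f {g g′} → g ≋ g′ → f ⊕ g ≋ f ⊕ g′
  ⊕-congˡ f = ⊕-cong (≋-refl {f})

  ⊕-congʳ : ∀ g {f f′} → f ≋ f′ → f ⊕ g ≋ f′ ⊕ g
  ⊕-congʳ g f≋f′ = ⊕-cong f≋f′ (≋-refl {g})

  ⊛-comm : ∀ f g → f ⊛ g ≋ g ⊛ f
  ⊛-comm f g = mk λ n → trans (Σ-reverse n (λ a b → f a * g b)) (Σ-cong n (λ k → *-comm _ _))

  ⊛-assoc : ∀ f g h → (f ⊛ g) ⊛ h ≋ f ⊛ (g ⊛ h)
  ⊛-assoc f g h = mk λ n → begin
    Σ≤ n (λ l → Σ≤ l (λ k → f k * g (l ∸ k)) * h (n ∸ l))   ≈⟨ Σ-cong n (λ l → Σ-*ʳ l _ _) ⟩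
    Σ≤ n (λ l → Σ≤ l (λ k → f k * g (l ∸ k) * h (n ∸ l)))   ≈⟨ Σ-triangle n (λ a b c → f a * g b * h c) ⟩
    Σ≤ n (λ k → Σ≤ (n ∸ k) (λ j → f k * g j * h (n ∸ k ∸ j)))
      ≈⟨ Σ-cong n (λ k → trans (Σ-cong (n ∸ k) (λ j → *-assoc _ _ _)) (sym (Σ-*ˡ (n ∸ k) _ _))) ⟩
    Σ≤ n (λ k → f k * Σ≤ (n ∸ k) (λ j → g j * h (n ∸ k ∸ j))) ∎

  ⊛-distribˡ : ∀ f g h → f ⊛ (g ⊕ h) ≋ (f ⊛ g) ⊕ (f ⊛ h)
  ⊛-distribˡ f g h = mk λ n → trans (Σ-cong n (λ k → distribˡ _ _ _)) (Σ-+ n _ _)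

  ⊛-distribʳ : ∀ f g h → (g ⊕ h) ⊛ f ≋ (g ⊛ f) ⊕ (h ⊛ f)
  ⊛-distribʳ f g h = mk λ n → trans (Σ-cong n (λ k → distribʳ _ _ _)) (Σ-+ n _ _)

  oneS-⊛ : ∀ f → oneS ⊛ f ≋ f
  oneS-⊛ f = mk λ n → trans (Σ-head n _ (λ k → zeroˡ _)) (*-identityˡ _)

  ⊛-oneS : ∀ f → f ⊛ oneS ≋ f
  ⊛-oneS f = ≋-trans (⊛-comm f oneS) (oneS-⊛ f)

  seriesRing : IsCommutativeRing _≋_ _⊕_ _⊛_ negS zeroS oneS
  seriesRing = record
    { isRing = record
      { +-isAbelianGroup = record
        { isGroup = record
          { isMonoid = record
            { isSemigroup = record
              { isMagma = record
                { isEquivalence = record { refl = ≋-refl ; sym = ≋-sym ; trans = ≋-trans }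
                ; ∙-cong = ⊕-cong }
              ; assoc = λ f g h → mk λ n → +-assoc _ _ _ }
            ; identity = (λ f → mk λ n → +-identityˡ _) , (λ f → mk λ n → +-identityʳ _) }
          ; inverse = (λ f → mk λ n → -‿inverseˡ _) , (λ f → mk λ n → -‿inverseʳ _)
          ; ⁻¹-cong = λ f≋g → mk λ n → -‿cong (at f≋g n) }
        ; comm = λ f g → mk λ n → +-comm _ _ }
      ; *-cong = ⊛-cong
      ; *-assoc = ⊛-assoc
      ; *-identity = oneS-⊛ , ⊛-oneS
      ; distrib = ⊛-distribˡ , ⊛-distribʳ }
    ; *-comm = ⊛-comm }

  PS-ring : CommutativeRing c ℓ
  PS-ring = record { isCommutativeRing = seriesRing }

  κ : Carrier → PS
  κ a zero    = a
  κ a (suc n) = 0#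

  κ-⊛ : ∀ a f → κ a ⊛ f ≋ scaleS a f
  κ-⊛ a f = mk λ n → Σ-head n _ (λ k → zeroˡ _)

  κ-cong : ∀ {a b} → a ≈ b → κ a ≋ κ b
  κ-cong a≈b = mk λ { zero → a≈b ; (suc n) → refl }

  κ-+ : ∀ a b → κ (a + b) ≋ κ a ⊕ κ b
  κ-+ a b = mk λ { zero → refl ; (suc n) → sym (+-identityʳ 0#) }

  κ-* : ∀ a b → κ (a * b) ≋ κ a ⊛ κ b
  κ-* a b = ≋-sym (≋-trans (κ-⊛ a (κ b)) (mk λ { zero → refl ; (suc n) → zeroʳ a }))

  κ-1 : κ 1# ≋ oneS
  κ-1 = mk λ { zero → refl ; (suc n) → refl }

  powS-constant : ∀ f k → powS f k 0 ≈ pow (f 0) k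
  powS-constant f zero    = refl
  powS-constant f (suc k) = *-congʳ (powS-constant f k)

  ΣS : ℕ → (ℕ → PS) → PS
  ΣS m Fs n = Σ≤ m (λ k → Fs k n)

  ΣS-cong : ∀ m {Fs Gs : ℕ → PS} → (∀ k → Fs k ≋ Gs k) → ΣS m Fs ≋ ΣS m Gs
  ΣS-cong m Fs≋Gs = mk λ n → Σ-cong m (λ k → at (Fs≋Gs k) n)

  ⊛-ΣS : ∀ m f (Fs : ℕ → PS) → f ⊛ ΣS m Fs ≋ ΣS m (λ k → f ⊛ Fs k)
  ⊛-ΣS m f Fs = mk λ n → trans (Σ-cong n (λ j → Σ-*ˡ m _ _)) (Σ-swap n m _)

module Derivative {c ℓ} (F : CharZeroField c ℓ) where
  open CharZeroField F
  open FPS F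
  open Sums F
  open FieldFacts F
  open SeriesRing F
  open RingProperties ring using (-0#≈0#)
  private
    module ≈R = SetoidReasoning setoid
    module ≋R = SetoidReasoning (CommutativeRing.setoid PS-ring)
    module 𝕊 = SemiringSolver (CommutativeRing.commutativeSemiring PS-ring)

  D : PS → PS
  D f n = nat (suc n) * f (suc n)

  D-cong : ∀ {f g} → f ≋ g → D f ≋ D g
  D-cong f≋g = mk λ n → *-congˡ (at f≋g (suc n))

  D-scale : ∀ a f → D (scaleS a f) ≋ scaleS a (D f)
  D-scale a f = mk λ n → trans (sym (*-assoc _ _ _)) (trans (*-congʳ (*-comm _ _)) (*-assoc _ _ _))

  D-ΣS : ∀ m (Fs : ℕ → PS) → D (ΣS m Fs) ≋ ΣS m (λ k → D (Fs k))
  D-ΣS m Fs = mk λ n → Σ-*ˡ m _ _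

  D-oneS : D oneS ≋ zeroS
  D-oneS = mk λ n → zeroʳ _

  D-⊖-oneS : ∀ f → D (f ⊖ oneS) ≋ D f
  D-⊖-oneS f = mk λ n → *-congˡ (trans (+-congˡ -0#≈0#) (+-identityʳ _))

  D-⊛ : ∀ f g → D (f ⊛ g) ≋ (D f ⊛ g) ⊕ (f ⊛ D g)
  D-⊛ f g = mk λ n → begin
    N n * Σ≤ (suc n) (λ k → f k * g (suc n ∸ k))              ≈⟨ Σ-*ˡ (suc n) _ _ ⟩
    Σ≤ (suc n) (λ k → N n * (f k * g (suc n ∸ k)))
      ≈⟨ Σ-cong≤ (suc n) (λ k k≤ → trans (*-congʳ (split k≤)) (spread _ _ _ _)) ⟩
    Σ≤ (suc n) (λ k → nat k * f k * g (suc n ∸ k) + f k * (nat (suc n ∸ k) * g (suc n ∸ k)))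
      ≈⟨ Σ-+ (suc n) _ _ ⟩
    Σ≤ (suc n) (λ k → nat k * f k * g (suc n ∸ k))
      + Σ≤ (suc n) (λ k → f k * (nat (suc n ∸ k) * g (suc n ∸ k)))
      ≈⟨ +-cong (trans (Σ-peel n _) (trans (+-congʳ (trans (*-congʳ (zeroˡ _)) (zeroˡ _))) (+-identityˡ _)))
                (trans (+-cong (Σ-cong≤ n (λ k k≤n → ≡⇒≈ (≡.cong (λ i → f k * (nat i * g i)) (ℕₚ.+-∸-assoc 1 k≤n))))
                               (vanish n))
                       (+-identityʳ _)) ⟩
    (D f ⊛ g) n + (f ⊛ D g) n ∎
    where
    open ≈R
    open SemiringSolver commutativeSemiring using (solve; _:=_; _:+_; _:*_)
    N : ℕ → Carrier
    N n = nat (suc n)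
    split : ∀ {k m} → k ≤ m → nat m ≈ nat k + nat (m ∸ k)
    split {k} {m} k≤m = trans (≡⇒≈ (≡.cong nat (≡.sym (ℕₚ.m+[n∸m]≡n k≤m)))) (nat-+ k (m ∸ k))
    spread : ∀ p q a b → (p + q) * (a * b) ≈ p * a * b + a * (q * b)
    spread = solve 4 (λ p q a b → (p :+ q) :* (a :* b) := p :* a :* b :+ a :* (q :* b)) refl
    vanish : ∀ n → f (suc n) * (nat (suc n ∸ suc n) * g (suc n ∸ suc n)) ≈ 0#
    vanish n = trans (*-congˡ (trans (*-congʳ (≡⇒≈ (≡.cong nat (ℕₚ.n∸n≡0 n)))) (zeroˡ _))) (zeroʳ _)

  D-pow : ∀ k G → D (powS G (suc k)) ≋ κ (nat (suc k)) ⊛ (powS G k ⊛ D G)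
  D-pow zero G = begin
    D (oneS ⊛ G)              ≈⟨ D-cong (oneS-⊛ G) ⟩
    D G                       ≈⟨ ≋-trans (oneS-⊛ (oneS ⊛ D G)) (oneS-⊛ (D G)) ⟨
    oneS ⊛ (oneS ⊛ D G)       ≈⟨ ⊛-congʳ (oneS ⊛ D G) (≋-trans (κ-cong (+-identityʳ 1#)) κ-1) ⟨
    κ (nat 1) ⊛ (oneS ⊛ D G)  ∎
    where open ≋R
  D-pow (suc k) G = begin
    D (P ⊛ G)                                   ≈⟨ D-⊛ P G ⟩
    (D P ⊛ G) ⊕ (P ⊛ D G)                       ≈⟨ ⊕-congʳ (P ⊛ D G) (⊛-congʳ G (D-pow k G)) ⟩
    ((κ N ⊛ (powS G k ⊛ D G)) ⊛ G) ⊕ (P ⊛ D G)  ≈⟨ collect (κ N) (powS G k) (D G) G ⟩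
    (oneS ⊕ κ N) ⊛ (P ⊛ D G)                    ≈⟨ ⊛-congʳ (P ⊛ D G) (≋-trans (κ-+ 1# N) (⊕-congʳ (κ N) κ-1)) ⟨
    κ (1# + N) ⊛ (P ⊛ D G)                      ∎
    where
    open ≋R
    open 𝕊 using (solve; _:=_; _:+_; _:*_; con)
    N = nat (suc k)
    P = powS G (suc k)
    collect : ∀ n p d g → ((n ⊛ (p ⊛ d)) ⊛ g) ⊕ ((p ⊛ g) ⊛ d) ≋ (oneS ⊕ n) ⊛ ((p ⊛ g) ⊛ d)
    collect = solve 4 (λ n p d g → (n :* (p :* d)) :* g :+ (p :* g) :* d
                                   := (con 1 :+ n) :* ((p :* g) :* d)) ≋-refl

  powS-vanishes : ∀ G → G 0 ≈ 0# → ∀ k n → n < k → powS G k n ≈ 0#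
  powS-vanishes G G₀≈0 (suc k) n n<k = Σ-zero n _ term
    where
    term : ∀ j → j ≤ n → powS G k j * G (n ∸ j) ≈ 0#
    term j j≤n with j ℕ.<? k
    ... | yes j<k = trans (*-congʳ (powS-vanishes G G₀≈0 k j j<k)) (zeroˡ _)
    ... | no j≮k  = trans (*-congˡ (trans (≡⇒≈ (≡.cong G (ℕₚ.m≤n⇒m∸n≡0 n≤j))) G₀≈0)) (zeroʳ _)
      where
      n≤j : n ≤ j
      n≤j = ℕₚ.≤-trans (ℕₚ.≤-pred n<k) (ℕₚ.≮⇒≥ j≮k)

  D-exp : ∀ G → G 0 ≈ 0# → D (expS G) ≋ D G ⊛ expS G
  D-exp G G₀≈0 = ≋-trans (mk coefficient) (⊛-comm (expS G) (D G))
    where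
    open ≈R
    term : ∀ n k → nat (suc n) * (powS G (suc k) (suc n) * fact (suc k) ⁻¹)
                   ≈ (powS G k ⊛ D G) n * fact k ⁻¹
    term n k = begin
      nat (suc n) * (powS G (suc k) (suc n) * fact (suc k) ⁻¹) ≈⟨ *-assoc _ _ _ ⟨
      D (powS G (suc k)) n * fact (suc k) ⁻¹
        ≈⟨ *-congʳ (trans (at (D-pow k G) n) (at (κ-⊛ (nat (suc k)) (powS G k ⊛ D G)) n)) ⟩
      (nat (suc k) * (powS G k ⊛ D G) n) * fact (suc k) ⁻¹       ≈⟨ *-congʳ (*-comm _ _) ⟩
      ((powS G k ⊛ D G) n * nat (suc k)) * fact (suc k) ⁻¹       ≈⟨ *-assoc _ _ _ ⟩
      (powS G k ⊛ D G) n * (nat (suc k) * fact (suc k) ⁻¹)       ≈⟨ *-congˡ (nat-fact-inverse k) ⟩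
      (powS G k ⊛ D G) n * fact k ⁻¹                            ∎
    coefficient : ∀ n → D (expS G) n ≈ (expS G ⊛ D G) n
    coefficient n = begin
      nat (suc n) * Σ≤ (suc n) (λ k → powS G k (suc n) * fact k ⁻¹)
        ≈⟨ trans (Σ-*ˡ (suc n) _ _) (Σ-peel n _) ⟩
      nat (suc n) * (0# * fact 0 ⁻¹) + Σ≤ n (λ k → nat (suc n) * (powS G (suc k) (suc n) * fact (suc k) ⁻¹))
        ≈⟨ +-cong (trans (*-congˡ (zeroˡ _)) (zeroʳ _)) (Σ-cong n (term n)) ⟩
      0# + Σ≤ n (λ k → Σ≤ n (λ l → powS G k l * D G (n ∸ l)) * fact k ⁻¹)
        ≈⟨ trans (+-identityˡ _) (Σ-cong n (λ k → trans (Σ-*ʳ n _ _) (Σ-cong n (λ l → swap₂ _ _ _)))) ⟩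
      Σ≤ n (λ k → Σ≤ n (λ l → powS G k l * fact k ⁻¹ * D G (n ∸ l)))
        ≈⟨ trans (Σ-swap n n _) (Σ-cong n (λ l → sym (Σ-*ʳ n (D G (n ∸ l)) (λ k → powS G k l * fact k ⁻¹)))) ⟩
      Σ≤ n (λ l → Σ≤ n (λ k → powS G k l * fact k ⁻¹) * D G (n ∸ l))
        ≈⟨ Σ-cong≤ n (λ l l≤n → *-congʳ (Σ-extend l n _ l≤n
             (λ k l<k → trans (*-congʳ (powS-vanishes G G₀≈0 k l l<k)) (zeroˡ _)))) ⟩
      (expS G ⊛ D G) n ∎
      where
      swap₂ : ∀ a b c → a * b * c ≈ a * c * b
      swap₂ a b c = trans (*-assoc _ _ _) (trans (*-congˡ (*-comm b c)) (sym (*-assoc _ _ _)))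

  D^ : ℕ → PS → PS
  D^ zero    f = f
  D^ (suc k) f = D (D^ k f)

  D^-coefficient : ∀ k f n → fact n * D^ k f n ≈ fact (n ℕ.+ k) * f (n ℕ.+ k)
  D^-coefficient zero    f n = ≡⇒≈ (≡.cong (λ i → fact i * f i) (≡.sym (ℕₚ.+-identityʳ n)))
  D^-coefficient (suc k) f n = begin
    fact n * (nat (suc n) * D^ k f (suc n)) ≈⟨ *-assoc _ _ _ ⟨
    fact (suc n) * D^ k f (suc n)           ≈⟨ D^-coefficient k f (suc n) ⟩
    fact (suc n ℕ.+ k) * f (suc n ℕ.+ k)    ≈⟨ ≡⇒≈ (≡.cong (λ i → fact i * f i) (≡.sym (ℕₚ.+-suc n k))) ⟩
    fact (n ℕ.+ suc k) * f (n ℕ.+ suc k)    ∎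
    where open ≈R

module BinomialSeries {c ℓ} (F : CharZeroField c ℓ) where
  open CharZeroField F
  open FPS F
  open Sums F
  open FieldFacts F
  open SeriesRing F
  open Derivative F
  open RingProperties ring using (-0#≈0#; -‿+-comm)
  open SetoidReasoning setoid
  open SemiringSolver commutativeSemiring using (solve; _:=_; _:+_; _:*_)

  linear : Carrier → PS
  linear α zero          = 1#
  linear α (suc zero)    = α
  linear α (suc (suc n)) = 0#

  binomS-cong : ∀ α {c c′} → c ≈ c′ → binomS α c ≋ binomS α c′
  binomS-cong α c≈c′ = mk λ n → *-congʳ (*-congʳ (Π-cong n (λ i → +-congʳ c≈c′)))

  binomS-0 : ∀ α c → binomS α c 0 ≈ 1#
  binomS-0 α c = trans (*-identityʳ _) (trans (*-identityˡ _) inverse-1)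

  falling-peel : ∀ n c → Π< (suc n) (λ i → c − nat i) ≈ c * Π< n (λ i → (c − 1#) − nat i)
  falling-peel n c = trans (Π-peel n _) (*-cong (trans (+-congˡ -0#≈0#) (+-identityʳ c))
    (Π-cong n (λ i → trans (+-congˡ (sym (-‿+-comm 1# (nat i)))) (sym (+-assoc _ _ _)))))

  binom-pascal : ∀ c n → binom (c − 1#) (suc n) + binom (c − 1#) n ≈ binom c (suc n)
  binom-pascal c n = begin
    Q * (c′ − nat n) * fact (suc n) ⁻¹ + Q * Fi
      ≈⟨ +-cong (*-congˡ (fact-suc-inverse n)) (trans (sym (*-identityʳ _)) (*-congˡ (sym Ni·N≈1))) ⟩
    Q * (c′ − nat n) * (Fi * Ni) + Q * Fi * (Ni * N) ≈⟨ factor Q (c′ − nat n) Fi Ni N ⟩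
    Q * (Fi * Ni) * ((c′ − nat n) + N)              ≈⟨ *-congˡ c′-n+N≈c ⟩
    Q * (Fi * Ni) * c                               ≈⟨ trans (*-comm _ _) (sym (*-assoc _ _ _)) ⟩
    c * Q * (Fi * Ni)                               ≈⟨ *-cong (sym (falling-peel n c)) (sym (fact-suc-inverse n)) ⟩
    binom c (suc n)                                 ∎
    where
    c′ = c − 1#
    Q  = Π< n (λ i → c′ − nat i)
    Fi = fact n ⁻¹
    N  = nat (suc n)
    Ni = N ⁻¹
    Ni·N≈1 : Ni * N ≈ 1#
    Ni·N≈1 = trans (*-comm _ _) (inverse N (charZero n))
    factor : ∀ q d f i m → q * d * (f * i) + q * f * (i * m) ≈ q * (f * i) * (d + m)
    factor = solve 5 (λ q d f i m → q :* d :* (f :* i) :+ q :* f :* (i :* m)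
                                    := q :* (f :* i) :* (d :+ m)) refl
    c′-n+N≈c : (c′ − nat n) + N ≈ c
    c′-n+N≈c = begin
      ((c + - 1#) + - nat n) + (1# + nat n) ≈⟨ +-assoc _ _ _ ⟩
      (c + - 1#) + (- nat n + (1# + nat n)) ≈⟨ +-congˡ (trans (+-congˡ (+-comm _ _)) (sym (+-assoc _ _ _))) ⟩
      (c + - 1#) + ((- nat n + nat n) + 1#) ≈⟨ +-congˡ (trans (+-congʳ (-‿inverseˡ _)) (+-identityˡ _)) ⟩
      (c + - 1#) + 1#                       ≈⟨ +-assoc _ _ _ ⟩
      c + (- 1# + 1#)                       ≈⟨ +-congˡ (-‿inverseˡ 1#) ⟩
      c + 0#                                ≈⟨ +-identityʳ c ⟩
      c                                     ∎

  pascal : ∀ α c → binomS α (c − 1#) ⊛ linear α ≋ binomS α c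
  pascal α c = ≋-trans (⊛-comm (binomS α (c − 1#)) (linear α)) (mk coefficient)
    where
    b′ = binomS α (c − 1#)
    coefficient : ∀ n → (linear α ⊛ b′) n ≈ binomS α c n
    coefficient zero    = *-identityˡ _
    coefficient (suc n) = begin
      Σ≤ (suc n) (λ k → linear α k * b′ (suc n ∸ k))                ≈⟨ Σ-peel n _ ⟩
      1# * b′ (suc n) + Σ≤ n (λ k → linear α (suc k) * b′ (n ∸ k))
        ≈⟨ +-cong (*-identityˡ _) (Σ-head n _ (λ k → zeroˡ _)) ⟩
      binom (c − 1#) (suc n) * (pow α n * α) + α * (binom (c − 1#) n * pow α n)
        ≈⟨ collect (binom (c − 1#) (suc n)) (binom (c − 1#) n) (pow α n) α ⟩
      (binom (c − 1#) (suc n) + binom (c − 1#) n) * (pow α n * α)   ≈⟨ *-congʳ (binom-pascal c n) ⟩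
      binomS α c (suc n)                                            ∎
      where
      collect : ∀ b b′ p a → b * (p * a) + a * (b′ * p) ≈ (b + b′) * (p * a)
      collect = solve 4 (λ b b′ p a → b :* (p :* a) :+ a :* (b′ :* p) := (b :+ b′) :* (p :* a)) refl

  D-binomS : ∀ α c → D (binomS α c) ≋ κ (α * c) ⊛ binomS α (c − 1#)
  D-binomS α c = ≋-trans (mk coefficient) (≋-sym (κ-⊛ (α * c) (binomS α (c − 1#))))
    where
    coefficient : ∀ n → D (binomS α c) n ≈ α * c * binomS α (c − 1#) n
    coefficient n = begin
      N * ((Π< (suc n) (λ i → c − nat i) * fact (suc n) ⁻¹) * (pow α n * α))
        ≈⟨ *-congˡ (*-congʳ (*-congʳ (falling-peel n c))) ⟩
      N * ((c * Q * fact (suc n) ⁻¹) * (pow α n * α))  ≈⟨ rearrange N c Q (fact (suc n) ⁻¹) (pow α n) α ⟩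
      α * c * ((Q * (N * fact (suc n) ⁻¹)) * pow α n)  ≈⟨ *-congˡ (*-congʳ (*-congˡ (nat-fact-inverse n))) ⟩
      α * c * ((Q * fact n ⁻¹) * pow α n)              ∎
      where
      N = nat (suc n)
      Q = Π< n (λ i → (c − 1#) − nat i)
      rearrange : ∀ m c q f p a → m * ((c * q * f) * (p * a)) ≈ a * c * ((q * (m * f)) * p)
      rearrange = solve 6 (λ m c q f p a → m :* ((c :* q :* f) :* (p :* a))
                                           := a :* c :* ((q :* (m :* f)) :* p)) refl

-- The values (jβ | β)_k vanish for
-- k > j and not for k = j, so the system  Σ_k a_k (jβ | β)_k  (j ≤ n) is
-- triangular with nonzero diagonal and determines a_0, …, a_n.
module FallingBasis {c ℓ} (F : CharZeroField c ℓ) (β : CharZeroField.Carrier F)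
                    (β≉0 : ¬ (CharZeroField._≈_ F β (CharZeroField.0# F))) where
  open CharZeroField F
  open FPS F
  open Sums F
  open FieldFacts F
  open RingProperties ring using (+-cancelˡ)
  open SetoidReasoning setoid

  node : ℕ → ℕ → Carrier
  node j k = falling (nat j * β) β k

  -- (jβ | β)_k has the factor jβ − jβ = 0 as soon as k > j
  node-vanishes : ∀ j k → j < k → node j k ≈ 0#
  node-vanishes j (suc k) j<1+k with j ℕ.<? k
  ... | yes j<k = trans (*-congʳ (node-vanishes j k j<k)) (zeroˡ _)
  ... | no j≮k  = trans (*-congˡ (trans (+-congʳ (*-congʳ (≡⇒≈ (≡.cong nat j≡k)))) (-‿inverseʳ _))) (zeroʳ _)
    where
    j≡k : j ≡ k
    j≡k = ℕₚ.≤-antisym (ℕₚ.≤-pred j<1+k) (ℕₚ.≮⇒≥ j≮k)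

  node-difference : ∀ i d → nat (i ℕ.+ d) * β − nat i * β ≈ nat d * β
  node-difference i d = begin
    nat (i ℕ.+ d) * β − nat i * β           ≈⟨ +-congʳ (trans (*-congʳ (nat-+ i d)) (distribʳ β _ _)) ⟩
    (nat i * β + nat d * β) + - (nat i * β) ≈⟨ +-congʳ (+-comm _ _) ⟩
    (nat d * β + nat i * β) + - (nat i * β) ≈⟨ +-assoc _ _ _ ⟩
    nat d * β + (nat i * β + - (nat i * β)) ≈⟨ +-congˡ (-‿inverseʳ _) ⟩
    nat d * β + 0#                          ≈⟨ +-identityʳ _ ⟩
    nat d * β                               ∎

  node-diagonal : ∀ j → ¬ (node j j ≈ 0#)
  node-diagonal j = Π-nonzero j _ factor≉0
    where
    factor≉0 : ∀ i → i < j → ¬ (nat j * β − nat i * β ≈ 0#)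
    factor≉0 i i<j factor≈0 = *-nonzero (charZero d) β≉0 (begin
      nat (suc d) * β                   ≈⟨ node-difference i (suc d) ⟨
      nat (i ℕ.+ suc d) * β − nat i * β ≈⟨ +-congʳ (*-congʳ (≡⇒≈ (≡.cong nat i+1+d≡j))) ⟩
      nat j * β − nat i * β             ≈⟨ factor≈0 ⟩
      0#                                ∎)
      where
      d = j ∸ suc i
      i+1+d≡j : i ℕ.+ suc d ≡ j
      i+1+d≡j = ≡.trans (ℕₚ.+-suc i d) (ℕₚ.m+[n∸m]≡n i<j)

  falling-basis-unique : ∀ n (a b : ℕ → Carrier) →
    (∀ j → j ≤ n → Σ≤ n (λ k → a k * node j k) ≈ Σ≤ n (λ k → b k * node j k)) →
    ∀ k → k ≤ n → a k ≈ b k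
  falling-basis-unique zero a b agree .0 z≤n =
    trans (sym (*-identityʳ _)) (trans (agree 0 z≤n) (*-identityʳ _))
  falling-basis-unique (suc n) a b agree = solution
    where
    -- the last term vanishes in the equations j ≤ n, which thus form the system of size n
    drop-last : ∀ (a : ℕ → Carrier) j → j ≤ n →
                Σ≤ (suc n) (λ k → a k * node j k) ≈ Σ≤ n (λ k → a k * node j k)
    drop-last a j j≤n = Σ-extend n (suc n) _ (ℕₚ.n≤1+n n)
      (λ k n<k → trans (*-congˡ (node-vanishes j k (ℕₚ.≤-<-trans j≤n n<k))) (zeroʳ _))
    lower : ∀ k → k ≤ n → a k ≈ b k
    lower = falling-basis-unique n a b
      (λ j j≤n → trans (sym (drop-last a j j≤n)) (trans (agree j (ℕₚ.m≤n⇒m≤1+n j≤n)) (drop-last b j j≤n)))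
    -- the equation j = n + 1 then isolates the diagonal term
    top : a (suc n) ≈ b (suc n)
    top = *-cancelˡ (node-diagonal (suc n)) (trans (*-comm _ _) (trans diagonal (*-comm _ _)))
      where
      diagonal : a (suc n) * node (suc n) (suc n) ≈ b (suc n) * node (suc n) (suc n)
      diagonal = +-cancelˡ _ _ _ (begin
        Σ≤ n (λ i → a i * node (suc n) i) + a (suc n) * node (suc n) (suc n) ≈⟨ agree (suc n) ℕₚ.≤-refl ⟩
        Σ≤ n (λ i → b i * node (suc n) i) + b (suc n) * node (suc n) (suc n)
          ≈⟨ +-congʳ (Σ-cong≤ n (λ i i≤n → *-congʳ (lower i i≤n))) ⟨
        Σ≤ n (λ i → a i * node (suc n) i) + b (suc n) * node (suc n) (suc n) ∎)
    solution : ∀ k → k ≤ suc n → a k ≈ b k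
    solution k k≤1+n with ℕₚ.m≤n⇒m<n∨m≡n k≤1+n
    ... | inj₁ k<1+n  = lower k (ℕₚ.≤-pred k<1+n)
    ... | inj₂ ≡.refl = top

-- The triangular recurrence of the generalised Stirling numbers,
--   S(m+1,k) = (γ − mα + kβ) S(m,k) + S(m,k−1),
-- obtained by expanding (t|α)_{m+1} = (t|α)_m (t − mα) in the basis
-- (t − γ | β)_k and comparing coefficients by FallingBasis.  It is stated
-- in the linear-functional form used later: Σ_k S(m+1,k) H_k for any H.
module StirlingRecurrence {c ℓ} (F : CharZeroField c ℓ) (α β γ : CharZeroField.Carrier F)
       (β≉0 : ¬ (CharZeroField._≈_ F β (CharZeroField.0# F)))
       (S : ℕ → ℕ → CharZeroField.Carrier F) (isStirling : FPS.IsGenStirling F α β γ S) where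
  open CharZeroField F
  open FPS F
  open Sums F
  open FallingBasis F β β≉0
  open SetoidReasoning setoid

  weight : ℕ → ℕ → Carrier
  weight m k = (γ − nat m * α) + nat k * β

  keptTerm : ℕ → ℕ → Carrier
  keptTerm m k with k ℕ.≤? m
  ... | yes _ = weight m k * S m k
  ... | no _  = 0#

  shiftedTerm : ℕ → ℕ → Carrier
  shiftedTerm m zero    = 0#
  shiftedTerm m (suc k) = S m k

  keptTerm-≤ : ∀ m k → k ≤ m → keptTerm m k ≈ weight m k * S m k
  keptTerm-≤ m k k≤m with k ℕ.≤? m
  ... | yes _   = refl
  ... | no k≰m = ⊥-elim (k≰m k≤m)

  keptTerm-top : ∀ m → keptTerm m (suc m) ≈ 0#
  keptTerm-top m with suc m ℕ.≤? m
  ... | yes 1+m≤m = ⊥-elim (ℕₚ.1+n≰n 1+m≤m)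
  ... | no _      = refl

  regroup : ∀ m (H : ℕ → Carrier) →
    Σ≤ (suc m) (λ k → (keptTerm m k + shiftedTerm m k) * H k)
    ≈ Σ≤ m (λ k → (weight m k * S m k) * H k) + Σ≤ m (λ k → S m k * H (suc k))
  regroup m H = begin
    Σ≤ (suc m) (λ k → (keptTerm m k + shiftedTerm m k) * H k)
      ≈⟨ trans (Σ-cong (suc m) (λ k → distribʳ _ _ _)) (Σ-+ (suc m) _ _) ⟩
    (Σ≤ m (λ k → keptTerm m k * H k) + keptTerm m (suc m) * H (suc m))
      + Σ≤ (suc m) (λ k → shiftedTerm m k * H k)
      ≈⟨ +-cong (trans (+-cong (Σ-cong≤ m (λ k k≤m → *-congʳ (keptTerm-≤ m k k≤m)))
                               (trans (*-congʳ (keptTerm-top m)) (zeroˡ _)))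
                       (+-identityʳ _))
                (trans (Σ-peel m _) (trans (+-congʳ (zeroˡ _)) (+-identityˡ _))) ⟩
    Σ≤ m (λ k → (weight m k * S m k) * H k) + Σ≤ m (λ k → S m k * H (suc k)) ∎

  split-factor : ∀ m k t → t − nat m * α ≈ ((t − γ) − nat k * β) + weight m k
  split-factor m k t = sym (begin
    ((t + - γ) + - K) + ((γ + - M) + K) ≈⟨ shuffle t (- M) (- γ) γ (- K) K ⟩
    (t + - M) + ((- γ + γ) + (- K + K)) ≈⟨ +-congˡ (trans (+-cong (-‿inverseˡ γ) (-‿inverseˡ K)) (+-identityʳ 0#)) ⟩
    (t + - M) + 0#                      ≈⟨ +-identityʳ _ ⟩
    t + - M                             ∎)
    where
    open SemiringSolver commutativeSemiring using (solve; _:=_; _:+_)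
    M = nat m * α
    K = nat k * β
    shuffle : ∀ t m g g′ k k′ → ((t + g) + k) + ((g′ + m) + k′) ≈ (t + m) + ((g + g′) + (k + k′))
    shuffle = solve 6 (λ t m g g′ k k′ → ((t :+ g) :+ k) :+ ((g′ :+ m) :+ k′)
                                        := (t :+ m) :+ ((g :+ g′) :+ (k :+ k′))) refl

  expansion : ∀ m t →
    Σ≤ (suc m) (λ k → S (suc m) k * falling (t − γ) β k)
    ≈ Σ≤ m (λ k → (weight m k * S m k) * falling (t − γ) β k)
      + Σ≤ m (λ k → S m k * falling (t − γ) β (suc k))
  expansion m t = begin
    Σ≤ (suc m) (λ k → S (suc m) k * B k)           ≈⟨ isStirling (suc m) t ⟨
    falling t α m * (t − nat m * α)                 ≈⟨ *-congʳ (isStirling m t) ⟩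
    Σ≤ m (λ k → S m k * B k) * (t − nat m * α)      ≈⟨ Σ-*ʳ m _ _ ⟩
    Σ≤ m (λ k → S m k * B k * (t − nat m * α))
      ≈⟨ Σ-cong m (λ k → trans (*-congˡ (split-factor m k t)) (spread _ _ _ _)) ⟩
    Σ≤ m (λ k → (weight m k * S m k) * B k + S m k * B (suc k)) ≈⟨ Σ-+ m _ _ ⟩
    Σ≤ m (λ k → (weight m k * S m k) * B k) + Σ≤ m (λ k → S m k * B (suc k)) ∎
    where
    open SemiringSolver commutativeSemiring using (solve; _:=_; _:+_; _:*_)
    B = falling (t − γ) β
    spread : ∀ s b x w → s * b * (x + w) ≈ (w * s) * b + s * (b * x)
    spread = solve 4 (λ s b x w → s :* b :* (x :+ w) := (w :* s) :* b :+ s :* (b :* x)) refl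

  coefficient-recurrence : ∀ m k → k ≤ suc m → S (suc m) k ≈ keptTerm m k + shiftedTerm m k
  coefficient-recurrence m = falling-basis-unique (suc m) (S (suc m)) (λ k → keptTerm m k + shiftedTerm m k) agree
    where
    agree : ∀ j → j ≤ suc m →
      Σ≤ (suc m) (λ k → S (suc m) k * node j k) ≈ Σ≤ (suc m) (λ k → (keptTerm m k + shiftedTerm m k) * node j k)
    agree j _ = begin
      Σ≤ (suc m) (λ k → S (suc m) k * node j k)      ≈⟨ Σ-cong (suc m) (λ k → *-congˡ (at-node k)) ⟩
      Σ≤ (suc m) (λ k → S (suc m) k * B k)           ≈⟨ trans (expansion m t) (sym (regroup m B)) ⟩
      Σ≤ (suc m) (λ k → (keptTerm m k + shiftedTerm m k) * B k)
        ≈⟨ Σ-cong (suc m) (λ k → *-congˡ (sym (at-node k))) ⟩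
      Σ≤ (suc m) (λ k → (keptTerm m k + shiftedTerm m k) * node j k) ∎
      where
      t = γ + nat j * β
      B = falling (t − γ) β
      t−γ≈jβ : t − γ ≈ nat j * β
      t−γ≈jβ = trans (+-assoc _ _ _) (trans (+-congˡ (+-comm _ _))
                 (trans (sym (+-assoc _ _ _)) (trans (+-congʳ (-‿inverseʳ γ)) (+-identityˡ _))))
      at-node : ∀ k → node j k ≈ B k
      at-node k = Π-cong k (λ i → +-congʳ (sym t−γ≈jβ))

  stirling-recurrence : ∀ m (H : ℕ → Carrier) →
    Σ≤ (suc m) (λ k → S (suc m) k * H k)
    ≈ Σ≤ m (λ k → (weight m k * S m k) * H k) + Σ≤ m (λ k → S m k * H (suc k))
  stirling-recurrence m H =
    trans (Σ-cong≤ (suc m) (λ k k≤1+m → *-congʳ (coefficient-recurrence m k k≤1+m))) (regroup m H)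

-- The
-- computation is organised around the operator θ f = W · Df, for which
-- u, Y and Y^k are eigenvectors (θY^k = kβ Y^k) and θE = Y E.
module GeneratingFunction {c ℓ} (F : CharZeroField c ℓ) (α β r x : CharZeroField.Carrier F)
       (α≉0 : ¬ (CharZeroField._≈_ F α (CharZeroField.0# F)))
       (β≉0 : ¬ (CharZeroField._≈_ F β (CharZeroField.0# F)))
       (S : ℕ → ℕ → CharZeroField.Carrier F) (isStirling : FPS.IsGenStirling F α β r S) where
  open CharZeroField F
  open FPS F
  open Sums F
  open FieldFacts F
  open SeriesRing F
  open Derivative F
  open BinomialSeries F
  open StirlingRecurrence F α β r β≉0 S isStirling using (weight; stirling-recurrence)
  open SetoidReasoning (CommutativeRing.setoid PS-ring)
  open SemiringSolver (CommutativeRing.commutativeSemiring PS-ring) using (solve; _:=_; _:+_; _:*_)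
  module ≈R = SetoidReasoning setoid

  W : PS
  W = linear α

  exponent : ℕ → Carrier
  exponent m = (r − nat m * α) * α ⁻¹

  A : ℕ → PS
  A m = binomS α (exponent m)

  u : PS
  u = binomS α (β * α ⁻¹)

  G E Y : PS
  G = scaleS (x * β ⁻¹) (u ⊖ oneS)
  E = expS G
  Y = scaleS x u

  P : ℕ → PS
  P m = expPolyS S m Y

  R : ℕ → PS
  R m = rhsS α β r x S m

  θ : PS → PS
  θ f = W ⊛ D f

  α⁻¹-cancel : ∀ a → α * (a * α ⁻¹) ≈ a
  α⁻¹-cancel a = ≈R.begin
    α * (a * α ⁻¹) ≈R.≈⟨ trans (*-congˡ (*-comm _ _)) (sym (*-assoc _ _ _)) ⟩
    (α * α ⁻¹) * a ≈R.≈⟨ trans (*-congʳ (inverse α α≉0)) (*-identityˡ a) ⟩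
    a              ≈R.∎

  exponent-suc : ∀ m → exponent m − 1# ≈ exponent (suc m)
  exponent-suc m = *-cancelˡ α≉0 (≈R.begin
    α * ((r − M) * α ⁻¹ − 1#)           ≈R.≈⟨ distribˡ α _ _ ⟩
    α * ((r − M) * α ⁻¹) + α * - 1#     ≈R.≈⟨ +-cong (α⁻¹-cancel (r − M)) (sym (-‿distribʳ-* α 1#)) ⟩
    (r − M) + - (α * 1#)                ≈R.≈⟨ +-assoc _ _ _ ⟩
    r + (- M + - (α * 1#))              ≈R.≈⟨ +-congˡ (trans (-‿+-comm _ _) (-‿cong (trans (+-comm _ _) (trans (+-congʳ (*-comm α 1#)) (sym (distribʳ α 1# (nat m))))))) ⟩
    r − nat (suc m) * α                 ≈R.≈⟨ α⁻¹-cancel _ ⟨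
    α * exponent (suc m)                ≈R.∎)
    where
    open RingProperties ring using (-‿distribʳ-*; -‿+-comm)
    M = nat m * α

  A-split : ∀ m → A m ≋ A (suc m) ⊛ W
  A-split m = ≋-trans (≋-sym (pascal α (exponent m)))
                      (⊛-congʳ W (binomS-cong α (exponent-suc m)))

  D-A : ∀ m → D (A m) ≋ κ (r − nat m * α) ⊛ A (suc m)
  D-A m = ≋-trans (D-binomS α (exponent m))
                  (⊛-cong (κ-cong (α⁻¹-cancel _)) (binomS-cong α (exponent-suc m)))

  θ-⊛ : ∀ f g → θ (f ⊛ g) ≋ (θ f ⊛ g) ⊕ (f ⊛ θ g)
  θ-⊛ f g = begin
    W ⊛ D (f ⊛ g)                    ≈⟨ ⊛-congˡ W (D-⊛ f g) ⟩
    W ⊛ ((D f ⊛ g) ⊕ (f ⊛ D g))      ≈⟨ distribute W (D f) g f (D g) ⟩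
    ((W ⊛ D f) ⊛ g) ⊕ (f ⊛ (W ⊛ D g)) ∎
    where
    distribute : ∀ w df g f dg → w ⊛ ((df ⊛ g) ⊕ (f ⊛ dg)) ≋ ((w ⊛ df) ⊛ g) ⊕ (f ⊛ (w ⊛ dg))
    distribute = solve 5 (λ w df g f dg → w :* ((df :* g) :+ (f :* dg))
                                         := ((w :* df) :* g) :+ (f :* (w :* dg))) ≋-refl

  θ-κ : ∀ a f → θ (κ a ⊛ f) ≋ κ a ⊛ θ f
  θ-κ a f = begin
    W ⊛ D (κ a ⊛ f)       ≈⟨ ⊛-congˡ W (D-cong (κ-⊛ a f)) ⟩
    W ⊛ D (scaleS a f)    ≈⟨ ⊛-congˡ W (≋-trans (D-scale a f) (≋-sym (κ-⊛ a (D f)))) ⟩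
    W ⊛ (κ a ⊛ D f)       ≈⟨ swap W (κ a) (D f) ⟩
    κ a ⊛ (W ⊛ D f)       ∎
    where
    swap : ∀ w k d → w ⊛ (k ⊛ d) ≋ k ⊛ (w ⊛ d)
    swap = solve 3 (λ w k d → w :* (k :* d) := k :* (w :* d)) ≋-refl

  -- θu = βu, since Du = β W^{β/α − 1} and W^{β/α − 1} W = u
  θ-u : θ u ≋ κ β ⊛ u
  θ-u = begin
    W ⊛ D u                 ≈⟨ ⊛-congˡ W (≋-trans (D-binomS α _) (⊛-congʳ V (κ-cong (α⁻¹-cancel β)))) ⟩
    W ⊛ (κ β ⊛ V)           ≈⟨ solve 3 (λ w b v → w :* (b :* v) := b :* (v :* w)) ≋-refl W (κ β) V ⟩
    κ β ⊛ (V ⊛ W)           ≈⟨ ⊛-congˡ (κ β) (pascal α _) ⟩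
    κ β ⊛ u                 ∎
    where V = binomS α (β * α ⁻¹ − 1#)

  θ-Y : θ Y ≋ κ β ⊛ Y
  θ-Y = begin
    θ Y               ≈⟨ ⊛-congˡ W (D-cong (≋-sym (κ-⊛ x u))) ⟩
    θ (κ x ⊛ u)       ≈⟨ θ-κ x u ⟩
    κ x ⊛ θ u         ≈⟨ ⊛-congˡ (κ x) θ-u ⟩
    κ x ⊛ (κ β ⊛ u)   ≈⟨ solve 3 (λ a b v → a :* (b :* v) := b :* (a :* v)) ≋-refl (κ x) (κ β) u ⟩
    κ β ⊛ (κ x ⊛ u)   ≈⟨ ⊛-congˡ (κ β) (κ-⊛ x u) ⟩
    κ β ⊛ Y           ∎

  θ-powY : ∀ k → θ (powS Y k) ≋ κ (nat k * β) ⊛ powS Y k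
  θ-powY zero = begin
    W ⊛ D oneS          ≈⟨ ⊛-congˡ W D-oneS ⟩
    W ⊛ zeroS           ≈⟨ solve 2 (λ w o → w :* con 0 := con 0 :* o) ≋-refl W oneS ⟩
    zeroS ⊛ oneS        ≈⟨ ⊛-congʳ oneS (mk λ { zero → zeroˡ β ; (suc n) → refl }) ⟨
    κ (0# * β) ⊛ oneS   ∎
    where open SemiringSolver (CommutativeRing.commutativeSemiring PS-ring) using (con)
  θ-powY (suc k) = begin
    θ (powS Y k ⊛ Y)                                ≈⟨ θ-⊛ (powS Y k) Y ⟩
    (θ (powS Y k) ⊛ Y) ⊕ (powS Y k ⊛ θ Y)           ≈⟨ ⊕-cong (⊛-congʳ Y (θ-powY k)) (⊛-congˡ (powS Y k) θ-Y) ⟩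
    ((κ K ⊛ powS Y k) ⊛ Y) ⊕ (powS Y k ⊛ (κ β ⊛ Y)) ≈⟨ collect (κ K) (κ β) (powS Y k) Y ⟩
    (κ β ⊕ κ K) ⊛ (powS Y k ⊛ Y)                    ≈⟨ ⊛-congʳ (powS Y (suc k)) (≋-trans (κ-cong (+-congʳ (*-identityˡ β))) (κ-+ β K)) ⟨
    κ (1# * β + K) ⊛ powS Y (suc k)                 ≈⟨ ⊛-congʳ (powS Y (suc k)) (κ-cong (sym (distribʳ β 1# (nat k)))) ⟩
    κ (nat (suc k) * β) ⊛ powS Y (suc k)            ∎
    where
    K = nat k * β
    collect : ∀ a b p y → ((a ⊛ p) ⊛ y) ⊕ (p ⊛ (b ⊛ y)) ≋ (b ⊕ a) ⊛ (p ⊛ y)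
    collect = solve 4 (λ a b p y → ((a :* p) :* y) :+ (p :* (b :* y)) := (b :+ a) :* (p :* y)) ≋-refl

  θ-P : ∀ m → θ (P m) ≋ ΣS m (λ k → scaleS (S m k * (nat k * β)) (powS Y k))
  θ-P m = ≋-trans (⊛-congˡ W (D-ΣS m Ts)) (≋-trans (⊛-ΣS m W (λ k → D (Ts k))) (ΣS-cong m term))
    where
    Ts : ℕ → PS
    Ts k = scaleS (S m k) (powS Y k)
    term : ∀ k → θ (scaleS (S m k) (powS Y k)) ≋ scaleS (S m k * (nat k * β)) (powS Y k)
    term k = begin
      θ (scaleS (S m k) (powS Y k))              ≈⟨ ⊛-congˡ W (D-cong (≋-sym (κ-⊛ (S m k) (powS Y k)))) ⟩
      θ (κ (S m k) ⊛ powS Y k)                   ≈⟨ θ-κ (S m k) (powS Y k) ⟩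
      κ (S m k) ⊛ θ (powS Y k)                   ≈⟨ ⊛-congˡ (κ (S m k)) (θ-powY k) ⟩
      κ (S m k) ⊛ (κ (nat k * β) ⊛ powS Y k)     ≈⟨ ⊛-assoc (κ (S m k)) (κ (nat k * β)) (powS Y k) ⟨
      (κ (S m k) ⊛ κ (nat k * β)) ⊛ powS Y k     ≈⟨ ⊛-congʳ (powS Y k) (κ-* (S m k) (nat k * β)) ⟨
      κ (S m k * (nat k * β)) ⊛ powS Y k         ≈⟨ κ-⊛ (S m k * (nat k * β)) (powS Y k) ⟩
      scaleS (S m k * (nat k * β)) (powS Y k)    ∎

  -- θE = Y E: the exponent G = (x/β)(u − 1) has θG = Y and no constant term
  θ-E : θ E ≋ Y ⊛ E
  θ-E = begin
    W ⊛ D E              ≈⟨ ⊛-congˡ W (D-exp G G₀≈0) ⟩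
    W ⊛ (D G ⊛ E)        ≈⟨ ⊛-assoc W (D G) E ⟨
    θ G ⊛ E              ≈⟨ ⊛-congʳ E θ-G ⟩
    Y ⊛ E                ∎
    where
    s = x * β ⁻¹
    G₀≈0 : G 0 ≈ 0#
    G₀≈0 = trans (*-congˡ (trans (+-congʳ (binomS-0 α (β * α ⁻¹))) (-‿inverseʳ 1#))) (zeroʳ s)
    θ-G : θ G ≋ Y
    θ-G = begin
      W ⊛ D G              ≈⟨ ⊛-congˡ W (D-scale s (u ⊖ oneS)) ⟩
      W ⊛ scaleS s (D (u ⊖ oneS))
        ≈⟨ ⊛-congˡ W (≋-trans (mk λ n → *-congˡ (at (D-⊖-oneS u) n)) (≋-sym (D-scale s u))) ⟩
      W ⊛ D (scaleS s u)   ≈⟨ ⊛-congˡ W (D-cong (≋-sym (κ-⊛ s u))) ⟩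
      θ (κ s ⊛ u)          ≈⟨ θ-κ s u ⟩
      κ s ⊛ θ u            ≈⟨ ⊛-congˡ (κ s) θ-u ⟩
      κ s ⊛ (κ β ⊛ u)      ≈⟨ ⊛-assoc (κ s) (κ β) u ⟨
      (κ s ⊛ κ β) ⊛ u      ≈⟨ ⊛-congʳ u (≋-trans (≋-sym (κ-* s β)) (κ-cong s·β≈x)) ⟩
      κ x ⊛ u              ≈⟨ κ-⊛ x u ⟩
      Y                    ∎
      where
      s·β≈x : s * β ≈ x
      s·β≈x = trans (*-assoc _ _ _) (trans (*-congˡ (trans (*-comm _ _) (inverse β β≉0))) (*-identityʳ x))

  θ-EP : ∀ m → θ (E ⊛ P m) ≋ E ⊛ ((Y ⊛ P m) ⊕ θ (P m))
  θ-EP m = begin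
    θ (E ⊛ P m)                          ≈⟨ θ-⊛ E (P m) ⟩
    (θ E ⊛ P m) ⊕ (E ⊛ θ (P m))          ≈⟨ ⊕-congʳ (E ⊛ θ (P m)) (⊛-congʳ (P m) θ-E) ⟩
    ((Y ⊛ E) ⊛ P m) ⊕ (E ⊛ θ (P m))      ≈⟨ factor Y E (P m) (θ (P m)) ⟩
    E ⊛ ((Y ⊛ P m) ⊕ θ (P m))            ∎
    where
    factor : ∀ y e p q → ((y ⊛ e) ⊛ p) ⊕ (e ⊛ q) ≋ e ⊛ ((y ⊛ p) ⊕ q)
    factor = solve 4 (λ y e p q → ((y :* e) :* p) :+ (e :* q) := e :* ((y :* p) :+ q)) ≋-refl

  Y-P : ∀ m → Y ⊛ P m ≋ ΣS m (λ k → scaleS (S m k) (powS Y (suc k)))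
  Y-P m = ≋-trans (⊛-ΣS m Y (λ k → scaleS (S m k) (powS Y k))) (ΣS-cong m term)
    where
    term : ∀ k → Y ⊛ scaleS (S m k) (powS Y k) ≋ scaleS (S m k) (powS Y (suc k))
    term k = begin
      Y ⊛ scaleS (S m k) (powS Y k)      ≈⟨ ⊛-congˡ Y (κ-⊛ (S m k) (powS Y k)) ⟨
      Y ⊛ (κ (S m k) ⊛ powS Y k)         ≈⟨ solve 3 (λ y s p → y :* (s :* p) := s :* (p :* y)) ≋-refl Y (κ (S m k)) (powS Y k) ⟩
      κ (S m k) ⊛ (powS Y k ⊛ Y)         ≈⟨ κ-⊛ (S m k) (powS Y (suc k)) ⟩
      scaleS (S m k) (powS Y (suc k))    ∎

  -- the Stirling recurrence in terms of P:  (r − mα) P_m + Y P_m + θ P_m = P_{m+1}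
  P-recurrence : ∀ m → (κ (r − nat m * α) ⊛ P m) ⊕ ((Y ⊛ P m) ⊕ θ (P m)) ≋ P (suc m)
  P-recurrence m = ≋-trans (⊕-cong (κ-⊛ ρ (P m)) (⊕-cong (Y-P m) (θ-P m))) (mk coefficient)
    where
    ρ = r − nat m * α
    coefficient : ∀ n →
      ρ * Σ≤ m (λ k → S m k * powS Y k n)
        + (Σ≤ m (λ k → S m k * powS Y (suc k) n) + Σ≤ m (λ k → (S m k * (nat k * β)) * powS Y k n))
      ≈ Σ≤ (suc m) (λ k → S (suc m) k * powS Y k n)
    coefficient n = ≈R.begin
      ρ * Σ≤ m (λ k → S m k * y k) + (Σ≤ m (λ k → S m k * y (suc k)) + Σ≤ m (λ k → (S m k * (nat k * β)) * y k))
        ≈R.≈⟨ +-congʳ (Σ-*ˡ m ρ _) ⟩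
      Σ≤ m (λ k → ρ * (S m k * y k)) + (Σ≤ m (λ k → S m k * y (suc k)) + Σ≤ m (λ k → (S m k * (nat k * β)) * y k))
        ≈R.≈⟨ rotate _ _ _ ⟩
      (Σ≤ m (λ k → ρ * (S m k * y k)) + Σ≤ m (λ k → (S m k * (nat k * β)) * y k)) + Σ≤ m (λ k → S m k * y (suc k))
        ≈R.≈⟨ +-congʳ (trans (sym (Σ-+ m _ _)) (Σ-cong m (λ k → weigh ρ (S m k) (nat k * β) (y k)))) ⟩
      Σ≤ m (λ k → (weight m k * S m k) * y k) + Σ≤ m (λ k → S m k * y (suc k))
        ≈R.≈⟨ stirling-recurrence m y ⟨
      Σ≤ (suc m) (λ k → S (suc m) k * y k) ≈R.∎
      where
      open SemiringSolver commutativeSemiring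
        renaming (solve to solveℂ; _:=_ to _:=ℂ_; _:+_ to _:+ℂ_; _:*_ to _:*ℂ_)
      y : ℕ → Carrier
      y k = powS Y k n
      rotate : ∀ a b c → a + (b + c) ≈ (a + c) + b
      rotate = solveℂ 3 (λ a b c → a :+ℂ (b :+ℂ c) :=ℂ (a :+ℂ c) :+ℂ b) refl
      weigh : ∀ ρ s k y → ρ * (s * y) + (s * k) * y ≈ ((ρ + k) * s) * y
      weigh = solveℂ 4 (λ ρ s k y → ρ :*ℂ (s :*ℂ y) :+ℂ (s :*ℂ k) :*ℂ y :=ℂ ((ρ :+ℂ k) :*ℂ s) :*ℂ y) refl

  D-R : ∀ m → D (R m) ≋ R (suc m)
  D-R m = begin
    D ((A m ⊛ E) ⊛ P m)                                ≈⟨ D-cong (⊛-assoc (A m) E (P m)) ⟩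
    D (A m ⊛ (E ⊛ P m))                                ≈⟨ D-⊛ (A m) (E ⊛ P m) ⟩
    (D (A m) ⊛ (E ⊛ P m)) ⊕ (A m ⊛ D (E ⊛ P m))
      ≈⟨ ⊕-cong (⊛-congʳ (E ⊛ P m) (D-A m)) (⊛-congʳ (D (E ⊛ P m)) (A-split m)) ⟩
    ((κ ρ ⊛ A′) ⊛ (E ⊛ P m)) ⊕ ((A′ ⊛ W) ⊛ D (E ⊛ P m))
      ≈⟨ ⊕-congˡ ((κ ρ ⊛ A′) ⊛ (E ⊛ P m)) (⊛-assoc A′ W (D (E ⊛ P m))) ⟩
    ((κ ρ ⊛ A′) ⊛ (E ⊛ P m)) ⊕ (A′ ⊛ θ (E ⊛ P m))      ≈⟨ ⊕-congˡ ((κ ρ ⊛ A′) ⊛ (E ⊛ P m)) (⊛-congˡ A′ (θ-EP m)) ⟩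
    ((κ ρ ⊛ A′) ⊛ (E ⊛ P m)) ⊕ (A′ ⊛ (E ⊛ Q))          ≈⟨ factor (κ ρ) A′ E (P m) Q ⟩
    (A′ ⊛ E) ⊛ ((κ ρ ⊛ P m) ⊕ Q)                       ≈⟨ ⊛-congˡ (A′ ⊛ E) (P-recurrence m) ⟩
    (A′ ⊛ E) ⊛ P (suc m)                               ∎
    where
    ρ  = r − nat m * α
    A′ = A (suc m)
    Q  = (Y ⊛ P m) ⊕ θ (P m)
    factor : ∀ k a e p q → ((k ⊛ a) ⊛ (e ⊛ p)) ⊕ (a ⊛ (e ⊛ q)) ≋ (a ⊛ e) ⊛ ((k ⊛ p) ⊕ q)
    factor = solve 5 (λ k a e p q → ((k :* a) :* (e :* p)) :+ (a :* (e :* q))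
                                   := (a :* e) :* ((k :* p) :+ q)) ≋-refl

  D^-R : ∀ m → D^ m (R 0) ≋ R m
  D^-R zero    = ≋-refl
  D^-R (suc m) = ≋-trans (D-cong (D^-R m)) (D-R m)

  R-constant : ∀ m → R m 0 ≈ expPoly S m x
  R-constant m = ≈R.begin
    (A m 0 * E 0) * P m 0                        ≈R.≈⟨ *-congʳ (trans (*-cong (binomS-0 α (exponent m)) E₀≈1) (*-identityˡ 1#)) ⟩
    1# * P m 0                                   ≈R.≈⟨ *-identityˡ _ ⟩
    Σ≤ m (λ k → S m k * powS Y k 0)              ≈R.≈⟨ Σ-cong m (λ k → *-congˡ (trans (powS-constant Y k) (pow-cong k Y₀≈x))) ⟩
    Σ≤ m (λ k → S m k * pow x k)                 ≈R.∎
    where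
    E₀≈1 : E 0 ≈ 1#
    E₀≈1 = trans (*-identityˡ _) inverse-1
    Y₀≈x : Y 0 ≈ x
    Y₀≈x = trans (*-congˡ (binomS-0 α (β * α ⁻¹))) (*-identityʳ x)
    pow-cong : ∀ k {a b} → a ≈ b → pow a k ≈ pow b k
    pow-cong zero    a≈b = refl
    pow-cong (suc k) a≈b = *-cong (pow-cong k a≈b) a≈b

  R₀-coefficient : ∀ N → fact N * R 0 N ≈ expPoly S N x
  R₀-coefficient N = ≈R.begin
    fact N * R 0 N           ≈R.≈⟨ D^-coefficient N (R 0) 0 ⟨
    1# * D^ N (R 0) 0        ≈R.≈⟨ *-identityˡ _ ⟩
    D^ N (R 0) 0             ≈R.≈⟨ at (D^-R N) 0 ⟩
    R N 0                    ≈R.≈⟨ R-constant N ⟩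
    expPoly S N x            ≈R.∎

mainTheorem8 : ∀ {c ℓ} (F : CharZeroField c ℓ) →
  let open CharZeroField F
      open FPS F
  in (α β r x : Carrier) → ¬ (α ≈ 0#) → ¬ (β ≈ 0#) →
     (S : ℕ → ℕ → Carrier) → IsGenStirling α β r S →
     (m n : ℕ) → lhsS S m x n ≈ rhsS α β r x S m n
mainTheorem8 F α β r x α≉0 β≉0 S isStirling m n = sym (divide-by-fact n (begin
  fact n * R m n                    ≈⟨ *-congˡ (at (D^-R m) n) ⟨
  fact n * D^ m (R 0) n             ≈⟨ D^-coefficient m (R 0) n ⟩
  fact (n ℕ.+ m) * R 0 (n ℕ.+ m)    ≈⟨ R₀-coefficient (n ℕ.+ m) ⟩
  expPoly S (n ℕ.+ m) x             ∎))
  where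
  open CharZeroField F
  open FPS F
  open FieldFacts F using (divide-by-fact)
  open SeriesRing F using (at)
  open Derivative F using (D^; D^-coefficient)
  open GeneratingFunction F α β r x α≉0 β≉0 S isStirling using (R; D^-R; R₀-coefficient)
  open SetoidReasoning setoid
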